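{- Let $n\geq 1$ and let $F:\mathbb{F}_2^n\to\mathbb{F}_2^n$ be a quadratic APN function. Then the function $\Phi_F:\mathbb{F}_2^n\to\mathbb{F}_2^n$ (defined in the context) takes an odd number of distinct nonzero values, i.e. $|\{\Phi_F(a) : a\in\mathbb{F}_2^n\}\setminus\{\mathbf{0}\}|$ is odd.
   Context: A vectorial Boolean function $F:\mathbb{F}_2^n\to\mathbb{F}_2^n$ is quadratic if its algebraic normal form has algebraic degree exactly $2$. $F$ is almost perfect nonlinear (APN) if for every $a,b\in\mathbb{F}_2^n$ with $a\neq\mathbf{0}$ the equation $F(x)+F(x+a)=b$ has at most $2$ solutions $x$. For a quadratic APN $F$ and nonzero $a$, the set $B_a(F)=\{F(x)+F(x+a): x\in\mathbb{F}_2^n\}$ is either a linear subspace of dimension $n-1$ or the complement of such a subspace; hence there are a unique nonzero vector $\Phi_F(a)\in\mathbb{F}_2^n$ and a unique bit $\varphi_F(a)\in\mathbb{F}_2$ with $B_a(F)=\{y\in\mathbb{F}_2^n: \Phi_F(a)\cdot y=\varphi_F(a)\}$, where $u\cdot y=\sum_i u_iy_i \bmod 2$. One sets $\Phi_F(\mathbf{0})=\mathbf{0}$ and $\varphi_F(\mathbf{0})=1$. (Equivalently, the Boolean function $\gamma_F(a,b)$, equal to $1$ iff $a\neq\mathbf{0}$ and $F(x)+F(x+a)=b$ is solvable, satisfies $\gamma_F(a,b)=\Phi_F(a)\cdot b+\varphi_F(a)+1$.) -}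

module Defs where

open import Data.Bool using (Bool; true; false; _xor_; _∧_; _∨_; not; if_then_else_; T)
open import Data.Nat using (ℕ; zero; suc; _⊔_; _≤_)
open import Data.List using (List; []; _∷_; map; _++_; foldr)
open import Data.Vec using (Vec; []; _∷_; zipWith; replicate)
open import Data.Product using (Σ; _×_; _,_)
open import Relation.Binary.PropositionalEquality using (_≡_)
open import Relation.Nullary using (¬_)

-- 𝔽₂ is modelled by Bool (false = 0, true = 1, addition = xor, product = ∧).
-- 𝔽₂ⁿ is modelled by Vec Bool n.
V : ℕ → Set
V n = Vec Bool n

zeroV : (n : ℕ) → V n
zeroV n = replicate n false

_⊕_ : {n : ℕ} → V n → V n → V n
_⊕_ = zipWith _xor_

_·_ : {n : ℕ} → V n → V n → Bool
[] · [] = false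
(u ∷ us) · (y ∷ ys) = (u ∧ y) xor (us · ys)

eqB : Bool → Bool → Bool
eqB a b = not (a xor b)

eqV : {n : ℕ} → V n → V n → Bool
eqV [] [] = true
eqV (a ∷ as) (b ∷ bs) = eqB a b ∧ eqV as bs

isZero : {n : ℕ} → V n → Bool
isZero {n} v = eqV v (zeroV n)

allV : (n : ℕ) → List (V n)
allV zero = [] ∷ []
allV (suc n) = map (false ∷_) (allV n) ++ map (true ∷_) (allV n)

anyV : (n : ℕ) → (V n → Bool) → Bool
anyV n p = foldr (λ x r → p x ∨ r) false (allV n)

allV? : (n : ℕ) → (V n → Bool) → Bool
allV? n p = foldr (λ x r → p x ∧ r) true (allV n)

countV : (n : ℕ) → (V n → Bool) → ℕ
countV n p = foldr (λ x r → if p x then suc r else r) 0 (allV n)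

wt : {n : ℕ} → V n → ℕ
wt [] = 0
wt (false ∷ v) = wt v
wt (true ∷ v) = suc (wt v)

_≼_ : {n : ℕ} → V n → V n → Bool
[] ≼ [] = true
(x ∷ xs) ≼ (u ∷ us) = (not x ∨ u) ∧ (xs ≼ us)

-- ANF coefficient (in 𝔽₂ⁿ) of the monomial x^u = Π_{uᵢ=1} xᵢ of
-- F : 𝔽₂ⁿ → 𝔽₂ᵐ, given by the Möbius transform  a_u = Σ_{x ≼ u} F(x).
-- (So F(x) = Σ_u a_u x^u.)
anfCoeff : {n m : ℕ} → (V n → V m) → V n → V m
anfCoeff {n} {m} F u =
  foldr (λ x acc → if x ≼ u then F x ⊕ acc else acc) (zeroV m) (allV n)

-- algebraic degree: maximal weight of a monomial with nonzero ANF coefficient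
-- (degree 0 for the zero function)
algDeg : {n m : ℕ} → (V n → V m) → ℕ
algDeg {n} F =
  foldr (λ u d → (if isZero (anfCoeff F u) then 0 else wt u) ⊔ d) 0 (allV n)

Quadratic : {n : ℕ} → (V n → V n) → Set
Quadratic F = algDeg F ≡ 2

δ : {n : ℕ} → (V n → V n) → V n → V n → ℕ
δ {n} F a b = countV n (λ x → eqV (F x ⊕ F (x ⊕ a)) b)

APN : {n : ℕ} → (V n → V n) → Set
APN {n} F = (a b : V n) → ¬ (a ≡ zeroV n) → δ F a b ≤ 2

inB : {n : ℕ} → (V n → V n) → V n → V n → Bool
inB {n} F a y = anyV n (λ x → eqV (F x ⊕ F (x ⊕ a)) y)

-- u (nonzero) together with bit c describe B_a(F):
-- B_a(F) = { y : u · y = c }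
describes : {n : ℕ} → (V n → V n) → V n → V n → Bool → Bool
describes {n} F a u c = not (isZero u) ∧ allV? n (λ y → eqB (inB F a y) (eqB (u · y) c))

findFirst : {A : Set} → (A → Bool) → A → List A → A
findFirst p d [] = d
findFirst p d (x ∷ xs) = if p x then x else findFirst p d xs

-- Φ_F(a): the (unique, for quadratic APN F and a ≠ 0) nonzero vector u such that
-- B_a(F) = { y : u · y = φ_F(a) } for some bit φ_F(a); Φ_F(0) = 0.
-- It is found by exhaustive search over 𝔽₂ⁿ (default 0 if no such u exists,
-- which never happens for quadratic APN F).
Φ : {n : ℕ} → (V n → V n) → V n → V n
Φ {n} F a =
  if isZero a then zeroV n
  else findFirst (λ u → describes F a u false ∨ describes F a u true) (zeroV n) (allV n)

nonzeroImageSize : {n : ℕ} → (V n → V n) → ℕ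
nonzeroImageSize {n} F =
  countV n (λ y → not (isZero y) ∧ anyV n (λ a → eqV (Φ F a) y))

module Submission where

-- Fix a ≠ 0 and write D_a F(x) = F(x) + F(x + a).  Because F has degree 2,
-- every third derivative of F vanishes, so L(x) = D_a F(x) + D_a F(0) is
-- linear and B_a(F) = Im L + D_a F(0).  APN-ness says ker L = {0, a}; a
-- character-sum count then shows that the annihilator of Im L is {0, u} for
-- a single u ≠ 0, so Im L = u^⊥ and Φ_F(a) = u.  Consequently, for y ≠ 0,
--     Φ_F(a) = y  ⟺  a ≠ 0 and y · D_a F is constant,
-- and { a : y · D_a F is constant } is a linear subspace S_y.  The fibre
-- Φ_F⁻¹(y) = S_y ∖ {0} therefore has odd size exactly when it is nonempty,
-- so modulo 2 the number of nonzero values of Φ_F equals the number of a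
-- with Φ_F(a) ≠ 0, namely 2ⁿ − 1, which is odd for n ≥ 1.

open import Defs
open import Data.Bool using (Bool; true; false; _xor_; _∧_; _∨_; not; if_then_else_)
open import Data.Bool.Properties
  using (xor-assoc; xor-comm; xor-identityˡ; xor-identityʳ; xor-same; true-xor;
         ∧-distribˡ-xor; ∧-zeroʳ; ∧-identityʳ; ∨-zeroʳ; not-involutive)
open import Data.Nat as ℕ using (ℕ; zero; suc; _≤_; _≥_; _%_; _^_; _⊔_; _∸_; z≤n; s≤s)
import Data.Nat.Properties as ℕP
open import Data.Integer as ℤ using (ℤ; +_; 0ℤ; 1ℤ; -1ℤ; -_)
  renaming (_+_ to _+ℤ_; _*_ to _*ℤ_)
import Data.Integer.Properties as ℤP
open import Data.List using (List; []; _∷_; map; _++_; foldr)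
open import Data.List.Relation.Unary.Any using (here; there)
open import Data.List.Membership.Propositional using (_∈_)
open import Data.List.Membership.Propositional.Properties using (∈-map⁺; ∈-++⁺ˡ; ∈-++⁺ʳ)
open import Data.Vec using ([]; _∷_)
open import Data.Vec.Properties
  using (zipWith-assoc; zipWith-comm; zipWith-identityˡ; zipWith-identityʳ)
open import Data.Product using (Σ-syntax; _×_; _,_; proj₁; proj₂)
open import Data.Sum using (_⊎_; inj₁; inj₂; fromInj₂)
open import Data.Empty using (⊥-elim)
open import Relation.Nullary using (¬_)
open import Relation.Binary.PropositionalEquality

true≢false : ¬ (true ≡ false)
true≢false ()

∧≡true : ∀ {a b} → a ∧ b ≡ true → (a ≡ true) × (b ≡ true)
∧≡true {true} {true} _ = refl , refl

bool-iff : ∀ {a b} → (a ≡ true → b ≡ true) → (b ≡ true → a ≡ true) → a ≡ b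
bool-iff {true}  {true}  _ _ = refl
bool-iff {false} {false} _ _ = refl
bool-iff {true}  {false} f _ = sym (f refl)
bool-iff {false} {true}  _ g = g refl

≡⇒xor≡false : ∀ {a b} → a ≡ b → a xor b ≡ false
≡⇒xor≡false {b = b} refl = xor-same b

eqB-refl : ∀ a → eqB a a ≡ true
eqB-refl true  = refl
eqB-refl false = refl

eqB-sound : ∀ a b → eqB a b ≡ true → a ≡ b
eqB-sound true  true  _ = refl
eqB-sound false false _ = refl

eqB-intro : ∀ {a b} → (a ≡ true → b ≡ true) → (b ≡ true → a ≡ true) → eqB a b ≡ true
eqB-intro {a} f g = subst (λ b → eqB a b ≡ true) (bool-iff f g) (eqB-refl a)

sumL : {A B : Set} → (A → A → A) → A → (B → A) → List B → A
sumL _∙_ ε f []       = ε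
sumL _∙_ ε f (x ∷ xs) = f x ∙ sumL _∙_ ε f xs

sumL-hom : {A A′ B : Set} {_∙_ : A → A → A} {ε : A} {_∙′_ : A′ → A′ → A′} {ε′ : A′}
  (h : A → A′) → h ε ≡ ε′ → (∀ x y → h (x ∙ y) ≡ h x ∙′ h y) →
  (f : B → A) (xs : List B) → h (sumL _∙_ ε f xs) ≡ sumL _∙′_ ε′ (λ x → h (f x)) xs
sumL-hom h hε h∙ f []       = hε
sumL-hom {_∙′_ = _∙′_} h hε h∙ f (x ∷ xs) =
  trans (h∙ _ _) (cong (h (f x) ∙′_) (sumL-hom h hε h∙ f xs))

module FiniteSum {A : Set} (_∙_ : A → A → A) (ε : A)
  (assoc : ∀ x y z → (x ∙ y) ∙ z ≡ x ∙ (y ∙ z))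
  (comm : ∀ x y → x ∙ y ≡ y ∙ x)
  (identityˡ : ∀ x → ε ∙ x ≡ x) where

  identityʳ : ∀ x → x ∙ ε ≡ x
  identityʳ x = trans (comm x ε) (identityˡ x)

  interchange : ∀ a b c d → (a ∙ b) ∙ (c ∙ d) ≡ (a ∙ c) ∙ (b ∙ d)
  interchange a b c d = begin
    (a ∙ b) ∙ (c ∙ d)  ≡⟨ assoc a b (c ∙ d) ⟩
    a ∙ (b ∙ (c ∙ d))  ≡⟨ cong (a ∙_) (sym (assoc b c d)) ⟩
    a ∙ ((b ∙ c) ∙ d)  ≡⟨ cong (λ z → a ∙ (z ∙ d)) (comm b c) ⟩
    a ∙ ((c ∙ b) ∙ d)  ≡⟨ cong (a ∙_) (assoc c b d) ⟩
    a ∙ (c ∙ (b ∙ d))  ≡⟨ sym (assoc a c (b ∙ d)) ⟩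
    (a ∙ c) ∙ (b ∙ d)  ∎
    where open ≡-Reasoning

  private
    sum : {B : Set} → (B → A) → List B → A
    sum = sumL _∙_ ε

    sum-++ : {B : Set} (f : B → A) (xs ys : List B) → sum f (xs ++ ys) ≡ sum f xs ∙ sum f ys
    sum-++ f []       ys = sym (identityˡ _)
    sum-++ f (x ∷ xs) ys = trans (cong (f x ∙_) (sum-++ f xs ys)) (sym (assoc _ _ _))

    sum-map : {B C : Set} (f : C → A) (g : B → C) (xs : List B) →
      sum f (map g xs) ≡ sum (λ x → f (g x)) xs
    sum-map f g []       = refl
    sum-map f g (x ∷ xs) = cong (f (g x) ∙_) (sum-map f g xs)

    sum-ext : {B : Set} {f g : B → A} → (∀ x → f x ≡ g x) → (xs : List B) → sum f xs ≡ sum g xs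
    sum-ext e []       = refl
    sum-ext e (x ∷ xs) = cong₂ _∙_ (e x) (sum-ext e xs)

    sum-ε : {B : Set} (xs : List B) → sum (λ _ → ε) xs ≡ ε
    sum-ε []       = refl
    sum-ε (x ∷ xs) = trans (identityˡ _) (sum-ε xs)

    sum-∙ : {B : Set} (f g : B → A) (xs : List B) →
      sum (λ x → f x ∙ g x) xs ≡ sum f xs ∙ sum g xs
    sum-∙ f g []       = sym (identityˡ ε)
    sum-∙ f g (x ∷ xs) = trans (cong ((f x ∙ g x) ∙_) (sum-∙ f g xs)) (interchange _ _ _ _)

    sum-swap : {B C : Set} (f : B → C → A) (xs : List B) (ys : List C) →
      sum (λ x → sum (f x) ys) xs ≡ sum (λ y → sum (λ x → f x y) xs) ys
    sum-swap f []       ys = sym (sum-ε ys)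
    sum-swap f (x ∷ xs) ys =
      trans (cong (sum (f x) ys ∙_) (sum-swap f xs ys))
            (sym (sum-∙ (f x) (λ y → sum (λ x → f x y) xs) ys))

  ∑ : (n : ℕ) → (V n → A) → A
  ∑ n f = sum f (allV n)

  ∑-ext : ∀ n {f g : V n → A} → (∀ x → f x ≡ g x) → ∑ n f ≡ ∑ n g
  ∑-ext n e = sum-ext e (allV n)

  ∑-ε : ∀ n → ∑ n (λ _ → ε) ≡ ε
  ∑-ε n = sum-ε (allV n)

  ∑-∙ : ∀ n (f g : V n → A) → ∑ n (λ x → f x ∙ g x) ≡ ∑ n f ∙ ∑ n g
  ∑-∙ n f g = sum-∙ f g (allV n)

  ∑-swap : ∀ n m (f : V n → V m → A) →
    ∑ n (λ x → ∑ m (f x)) ≡ ∑ m (λ y → ∑ n (λ x → f x y))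
  ∑-swap n m f = sum-swap f (allV n) (allV m)

  ∑-suc : ∀ n (f : V (suc n) → A) →
    ∑ (suc n) f ≡ ∑ n (λ x → f (false ∷ x)) ∙ ∑ n (λ x → f (true ∷ x))
  ∑-suc n f = trans (sum-++ f (map (false ∷_) (allV n)) (map (true ∷_) (allV n)))
                    (cong₂ _∙_ (sum-map f (false ∷_) (allV n)) (sum-map f (true ∷_) (allV n)))

  -- translation x ↦ x + c is a bijection of 𝔽₂ⁿ
  ∑-translate : ∀ n (f : V n → A) (c : V n) → ∑ n (λ x → f (x ⊕ c)) ≡ ∑ n f
  ∑-translate zero    f []          = refl
  ∑-translate (suc n) f (false ∷ c) =
    trans (∑-suc n _)
    (trans (cong₂ _∙_ (∑-translate n (λ x → f (false ∷ x)) c) (∑-translate n (λ x → f (true ∷ x)) c))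
    (sym (∑-suc n f)))
  ∑-translate (suc n) f (true ∷ c) =
    trans (∑-suc n _)
    (trans (cong₂ _∙_ (∑-translate n (λ x → f (true ∷ x)) c) (∑-translate n (λ x → f (false ∷ x)) c))
    (trans (comm _ _) (sym (∑-suc n f))))

  ∑-delta : ∀ n (f : V n → A) (w : V n) → ∑ n (λ x → if eqV x w then f x else ε) ≡ f w
  ∑-delta zero    f []          = identityʳ _
  ∑-delta (suc n) f (false ∷ w) =
    trans (∑-suc n _) (trans (cong₂ _∙_ (∑-delta n (λ x → f (false ∷ x)) w) (∑-ε n)) (identityʳ _))
  ∑-delta (suc n) f (true ∷ w) =
    trans (∑-suc n _) (trans (cong₂ _∙_ (∑-ε n) (∑-delta n (λ x → f (true ∷ x)) w)) (identityˡ _))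

module ParSum = FiniteSum _xor_ false xor-assoc xor-comm xor-identityˡ
module NatSum = FiniteSum ℕ._+_ 0 ℕP.+-assoc ℕP.+-comm ℕP.+-identityˡ
module IntSum = FiniteSum _+ℤ_ 0ℤ ℤP.+-assoc ℤP.+-comm ℤP.+-identityˡ

⊕-assoc : ∀ {n} (x y z : V n) → (x ⊕ y) ⊕ z ≡ x ⊕ (y ⊕ z)
⊕-assoc = zipWith-assoc xor-assoc

⊕-comm : ∀ {n} (x y : V n) → x ⊕ y ≡ y ⊕ x
⊕-comm = zipWith-comm xor-comm

⊕-identityˡ : ∀ {n} (x : V n) → zeroV n ⊕ x ≡ x
⊕-identityˡ = zipWith-identityˡ xor-identityˡ

⊕-identityʳ : ∀ {n} (x : V n) → x ⊕ zeroV n ≡ x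
⊕-identityʳ = zipWith-identityʳ xor-identityʳ

⊕-self : ∀ {n} (x : V n) → x ⊕ x ≡ zeroV n
⊕-self []      = refl
⊕-self (a ∷ x) = cong₂ _∷_ (xor-same a) (⊕-self x)

module VecSum (m : ℕ) = FiniteSum (_⊕_ {m}) (zeroV m) ⊕-assoc ⊕-comm ⊕-identityˡ

⊕-cancelʳ : ∀ {n} (x y : V n) → (x ⊕ y) ⊕ y ≡ x
⊕-cancelʳ x y = trans (⊕-assoc x y y) (trans (cong (x ⊕_) (⊕-self y)) (⊕-identityʳ x))

⊕-telescope : ∀ {n} (p q r : V n) → (p ⊕ q) ⊕ (q ⊕ r) ≡ p ⊕ r
⊕-telescope p q r =
  trans (sym (⊕-assoc (p ⊕ q) q r)) (cong (_⊕ r) (⊕-cancelʳ p q))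

⊕≡0⇒≡ : ∀ {n} (x y : V n) → x ⊕ y ≡ zeroV n → x ≡ y
⊕≡0⇒≡ {n} x y e = begin
  x                 ≡⟨ sym (⊕-cancelʳ x y) ⟩
  (x ⊕ y) ⊕ y       ≡⟨ cong (_⊕ y) e ⟩
  zeroV n ⊕ y       ≡⟨ ⊕-identityˡ y ⟩
  y                 ∎
  where open ≡-Reasoning

·-⊕ : ∀ {n} (v x y : V n) → v · (x ⊕ y) ≡ (v · x) xor (v · y)
·-⊕ []      []      []      = refl
·-⊕ (a ∷ v) (b ∷ x) (c ∷ y) =
  trans (cong₂ _xor_ (∧-distribˡ-xor a b c) (·-⊕ v x y))
        (ParSum.interchange (a ∧ b) (a ∧ c) (v · x) (v · y))

·-zeroʳ : ∀ {n} (v : V n) → v · zeroV n ≡ false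
·-zeroʳ []      = refl
·-zeroʳ (a ∷ v) = trans (cong (_xor (v · zeroV _)) (∧-zeroʳ a)) (·-zeroʳ v)

·-zeroˡ : ∀ {n} (v : V n) → zeroV n · v ≡ false
·-zeroˡ []      = refl
·-zeroˡ (a ∷ v) = ·-zeroˡ v

eqV-refl : ∀ {n} (x : V n) → eqV x x ≡ true
eqV-refl []      = refl
eqV-refl (a ∷ x) = cong₂ _∧_ (eqB-refl a) (eqV-refl x)

eqV-sound : ∀ {n} (x y : V n) → eqV x y ≡ true → x ≡ y
eqV-sound []      []      _ = refl
eqV-sound (a ∷ x) (b ∷ y) e =
  cong₂ _∷_ (eqB-sound a b (proj₁ (∧≡true e))) (eqV-sound x y (proj₂ (∧≡true {eqB a b} e)))

eqV-false : ∀ {n} (x y : V n) → ¬ (x ≡ y) → eqV x y ≡ false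
eqV-false x y x≢y with eqV x y in e
... | true  = ⊥-elim (x≢y (eqV-sound x y e))
... | false = refl

eqV-comm : ∀ {n} (x y : V n) → eqV x y ≡ eqV y x
eqV-comm []      []      = refl
eqV-comm (a ∷ x) (b ∷ y) = cong₂ (λ p q → not p ∧ q) (xor-comm a b) (eqV-comm x y)

eqV-⊕ : ∀ {n} (x y : V n) → eqV x y ≡ isZero (x ⊕ y)
eqV-⊕ []      []      = refl
eqV-⊕ (a ∷ x) (b ∷ y) =
  cong₂ (λ p q → not p ∧ q) (sym (xor-identityʳ (a xor b))) (eqV-⊕ x y)

isZero-zero : ∀ n → isZero (zeroV n) ≡ true
isZero-zero n = eqV-refl (zeroV n)

isZero-sound : ∀ {n} (v : V n) → isZero v ≡ true → v ≡ zeroV n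
isZero-sound {n} v = eqV-sound v (zeroV n)

isZero-false : ∀ {n} (v : V n) → isZero v ≡ false → ¬ (v ≡ zeroV n)
isZero-false {n} v e refl = true≢false (trans (sym (isZero-zero n)) e)

allV-complete : ∀ n (x : V n) → x ∈ allV n
allV-complete zero    []          = here refl
allV-complete (suc n) (false ∷ x) = ∈-++⁺ˡ (∈-map⁺ (false ∷_) (allV-complete n x))
allV-complete (suc n) (true ∷ x)  =
  ∈-++⁺ʳ (map (false ∷_) (allV n)) (∈-map⁺ (true ∷_) (allV-complete n x))

anyV-intro : ∀ n (p : V n → Bool) x → p x ≡ true → anyV n p ≡ true
anyV-intro n p x px = go (allV-complete n x)
  where
  go : ∀ {xs} → x ∈ xs → foldr (λ x r → p x ∨ r) false xs ≡ true
  go (here refl) rewrite px = refl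
  go (there {y} x∈xs) with p y
  ... | true  = refl
  ... | false = go x∈xs

anyV-elim : ∀ n (p : V n → Bool) → anyV n p ≡ true → Σ[ x ∈ V n ] p x ≡ true
anyV-elim n p = go (allV n)
  where
  go : ∀ xs → foldr (λ x r → p x ∨ r) false xs ≡ true → Σ[ x ∈ V n ] p x ≡ true
  go (x ∷ xs) e with p x in px
  ... | true  = x , px
  ... | false = go xs e

allV-intro : ∀ n (p : V n → Bool) → (∀ x → p x ≡ true) → allV? n p ≡ true
allV-intro n p h = go (allV n)
  where
  go : ∀ xs → foldr (λ x r → p x ∧ r) true xs ≡ true
  go []       = refl
  go (x ∷ xs) rewrite h x = go xs

allV-elim : ∀ n (p : V n → Bool) → allV? n p ≡ true → ∀ x → p x ≡ true
allV-elim n p e x = go e (allV-complete n x)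
  where
  go : ∀ {xs} → foldr (λ x r → p x ∧ r) true xs ≡ true → x ∈ xs → p x ≡ true
  go e (here refl)          = proj₁ (∧≡true e)
  go {y ∷ _} e (there x∈xs) = go (proj₂ (∧≡true {p y} e)) x∈xs

allV-false : ∀ n (p : V n → Bool) → allV? n p ≡ false → Σ[ x ∈ V n ] p x ≡ false
allV-false n p = go (allV n)
  where
  go : ∀ xs → foldr (λ x r → p x ∧ r) true xs ≡ false → Σ[ x ∈ V n ] p x ≡ false
  go (x ∷ xs) e with p x in px
  ... | false = x , px
  ... | true  = go xs e

findFirst-unique : ∀ {A : Set} (p : A → Bool) (d w : A) (xs : List A) → w ∈ xs →
  p w ≡ true → (∀ v → p v ≡ true → v ≡ w) → findFirst p d xs ≡ w
findFirst-unique p d w (x ∷ xs) w∈ pw uniq with p x in px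
... | true = uniq x px
findFirst-unique p d w (x ∷ xs) (here refl)  pw uniq | false = ⊥-elim (true≢false (trans (sym pw) px))
findFirst-unique p d w (x ∷ xs) (there w∈xs) pw uniq | false = findFirst-unique p d w xs w∈xs pw uniq

indN : Bool → ℕ
indN true  = 1
indN false = 0

countV-sum : ∀ n (p : V n → Bool) → countV n p ≡ NatSum.∑ n (λ x → indN (p x))
countV-sum n p = go (allV n)
  where
  go : ∀ xs → foldr (λ x r → if p x then suc r else r) 0 xs ≡ sumL ℕ._+_ 0 (λ x → indN (p x)) xs
  go []       = refl
  go (x ∷ xs) with p x
  ... | true  = cong suc (go xs)
  ... | false = go xs

countV-ext : ∀ n {p q : V n → Bool} → (∀ x → p x ≡ q x) → countV n p ≡ countV n q
countV-ext n {p} {q} e =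
  trans (countV-sum n p) (trans (NatSum.∑-ext n (λ x → cong indN (e x))) (sym (countV-sum n q)))

count-split : ∀ n (p : V n → Bool) (w : V n) →
  countV n p ≡ countV n (λ x → p x ∧ not (eqV x w)) ℕ.+ indN (p w)
count-split n p w =
  trans (countV-sum n p)
  (trans (NatSum.∑-ext n split-point)
  (trans (NatSum.∑-∙ n _ _)
  (cong₂ ℕ._+_ (sym (countV-sum n _)) (NatSum.∑-delta n (λ x → indN (p x)) w))))
  where
  split-point : ∀ x → indN (p x) ≡ indN (p x ∧ not (eqV x w)) ℕ.+ (if eqV x w then indN (p x) else 0)
  split-point x with eqV x w
  ... | true  = cong (λ b → indN b ℕ.+ indN (p x)) (sym (∧-zeroʳ (p x)))
  ... | false = trans (cong indN (sym (∧-identityʳ (p x)))) (sym (ℕP.+-identityʳ _))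

count-pos : ∀ n (p : V n → Bool) {k} → countV n p ≡ suc k → Σ[ x ∈ V n ] p x ≡ true
count-pos n p = go (allV n)
  where
  go : ∀ xs {k} → foldr (λ x r → if p x then suc r else r) 0 xs ≡ suc k → Σ[ x ∈ V n ] p x ≡ true
  go (x ∷ xs) e with p x in px
  ... | true  = x , px
  ... | false = go xs e

count-zero : ∀ n (p : V n → Bool) → countV n p ≡ 0 → ∀ x → p x ≡ false
count-zero n p e x = indN≡0 (p x) (ℕP.m+n≡0⇒n≡0 _ (trans (sym (count-split n p x)) e))
  where
  indN≡0 : ∀ b → indN b ≡ 0 → b ≡ false
  indN≡0 false _ = refl

count≥2 : ∀ n (p : V n → Bool) (w₁ w₂ : V n) → ¬ (w₂ ≡ w₁) →
  p w₁ ≡ true → p w₂ ≡ true → 2 ≤ countV n p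
count≥2 n p w₁ w₂ w₂≢w₁ p₁ p₂
  rewrite count-split n p w₁ | count-split n (λ x → p x ∧ not (eqV x w₁)) w₂
        | p₁ | p₂ | eqV-false w₂ w₁ w₂≢w₁
  = subst (2 ≤_) (sym (ℕP.+-assoc _ 1 1)) (ℕP.m≤n+m 2 _)

count≡2 : ∀ n (p : V n → Bool) (w : V n) → countV n p ≡ 2 → p w ≡ true →
  Σ[ u ∈ V n ] ¬ (u ≡ w) × p u ≡ true × (∀ v → p v ≡ true → (v ≡ w) ⊎ (v ≡ u))
count≡2 n p w count₂ pw = u , u≢w , pu , other-is-u
  where
  p′ : V n → Bool
  p′ x = p x ∧ not (eqV x w)

  count′ : countV n p′ ≡ 1
  count′ = ℕP.+-cancelʳ-≡ 1 _ 1
    (trans (sym (subst (λ b → countV n p ≡ countV n p′ ℕ.+ indN b) pw (count-split n p w))) count₂)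

  witness : Σ[ x ∈ V n ] p′ x ≡ true
  witness = count-pos n p′ count′

  u : V n
  u = proj₁ witness

  pu : p u ≡ true
  pu = proj₁ (∧≡true (proj₂ witness))

  u≢w : ¬ (u ≡ w)
  u≢w u≡w = true≢false (trans (sym (proj₂ (∧≡true {p u} (proj₂ witness))))
                             (cong not (trans (cong (eqV u) (sym u≡w)) (eqV-refl u))))

  no-third : countV n (λ x → p′ x ∧ not (eqV x u)) ≡ 0
  no-third = ℕP.+-cancelʳ-≡ 1 _ 0
    (trans (sym (subst (λ b → countV n p′ ≡ countV n (λ x → p′ x ∧ not (eqV x u)) ℕ.+ indN b)
                       (proj₂ witness) (count-split n p′ u)))
           count′)

  other-is-u : ∀ v → p v ≡ true → (v ≡ w) ⊎ (v ≡ u)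
  other-is-u v pv with eqV v w in vw | eqV v u in vu
  ... | true  | _     = inj₁ (eqV-sound v w vw)
  ... | false | true  = inj₂ (eqV-sound v u vu)
  ... | false | false = ⊥-elim (true≢false (trans (sym third) (count-zero n _ no-third v)))
    where
    third : (p v ∧ not (eqV v w)) ∧ not (eqV v u) ≡ true
    third rewrite pv | vw | vu = refl

parity : ℕ → Bool
parity zero    = false
parity (suc k) = not (parity k)

parity-+ : ∀ a b → parity (a ℕ.+ b) ≡ parity a xor parity b
parity-+ zero    b = refl
parity-+ (suc a) b = trans (cong not (parity-+ a b)) (not-xor (parity a) (parity b))
  where
  not-xor : ∀ x y → not (x xor y) ≡ not x xor y
  not-xor true  y = not-involutive y
  not-xor false y = refl

parity-count : ∀ n (p : V n → Bool) → parity (countV n p) ≡ ParSum.∑ n p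
parity-count n p =
  trans (cong parity (countV-sum n p))
  (trans (sumL-hom parity refl parity-+ (λ x → indN (p x)) (allV n))
         (ParSum.∑-ext n (λ x → parity-indN (p x))))
  where
  parity-indN : ∀ b → parity (indN b) ≡ b
  parity-indN true  = refl
  parity-indN false = refl

parity-odd : ∀ m → parity m ≡ true → m % 2 ≡ 1
parity-odd (suc zero)    _ = refl
parity-odd (suc (suc m)) e = parity-odd m (trans (sym (not-involutive (parity m))) e)

-- Algebraic degree and derivatives

anf-sum : ∀ {n m} (f : V n → V m) (u : V n) →
  anfCoeff f u ≡ VecSum.∑ m n (λ x → if x ≼ u then f x else zeroV m)
anf-sum {n} {m} f u = go (allV n)
  where
  go : ∀ xs → foldr (λ x acc → if x ≼ u then f x ⊕ acc else acc) (zeroV m) xs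
            ≡ sumL _⊕_ (zeroV m) (λ x → if x ≼ u then f x else zeroV m) xs
  go []       = refl
  go (x ∷ xs) with x ≼ u
  ... | true  = cong (f x ⊕_) (go xs)
  ... | false = trans (go xs) (sym (⊕-identityˡ _))

Deg< : ∀ {n m} → (V n → V m) → ℕ → Set
Deg< {n} {m} f k = ∀ u → k ≤ wt u → anfCoeff f u ≡ zeroV m

anf-ext : ∀ {n m} {f g : V n → V m} → (∀ x → f x ≡ g x) → ∀ u → anfCoeff f u ≡ anfCoeff g u
anf-ext {n} {m} {f} {g} e u =
  trans (anf-sum f u)
  (trans (VecSum.∑-ext m n (λ x → cong (λ z → if x ≼ u then z else zeroV m) (e x)))
         (sym (anf-sum g u)))

anf-⊕ : ∀ {n m} (f g : V n → V m) u →
  anfCoeff (λ x → f x ⊕ g x) u ≡ anfCoeff f u ⊕ anfCoeff g u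
anf-⊕ {n} {m} f g u =
  trans (anf-sum _ u)
  (trans (VecSum.∑-ext m n (λ x → if-⊕ (x ≼ u)))
  (trans (VecSum.∑-∙ m n _ _) (sym (cong₂ _⊕_ (anf-sum f u) (anf-sum g u)))))
  where
  if-⊕ : ∀ b {p q : V m} →
    (if b then p ⊕ q else zeroV m) ≡ (if b then p else zeroV m) ⊕ (if b then q else zeroV m)
  if-⊕ true  = refl
  if-⊕ false = sym (⊕-identityˡ (zeroV m))

anf-zero : ∀ {n m} (u : V n) → anfCoeff (λ (_ : V n) → zeroV m) u ≡ zeroV m
anf-zero {n} {m} u =
  trans (anf-sum _ u) (trans (VecSum.∑-ext m n (λ x → if-same (x ≼ u))) (VecSum.∑-ε m n))
  where
  if-same : ∀ b → (if b then zeroV m else zeroV m) ≡ zeroV m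
  if-same true  = refl
  if-same false = refl

Deg<-ext : ∀ {n m} {f g : V n → V m} {k} → (∀ x → f x ≡ g x) → Deg< f k → Deg< g k
Deg<-ext e d u le = trans (sym (anf-ext e u)) (d u le)

Deg<-⊕ : ∀ {n m} {f g : V n → V m} {k} → Deg< f k → Deg< g k → Deg< (λ x → f x ⊕ g x) k
Deg<-⊕ {m = m} {f} {g} df dg u le =
  trans (anf-⊕ f g u) (trans (cong₂ _⊕_ (df u le) (dg u le)) (⊕-identityˡ (zeroV m)))

Deg<-mono : ∀ {n m} {f : V n → V m} {j k} → j ≤ k → Deg< f j → Deg< f k
Deg<-mono j≤k d u le = d u (ℕP.≤-trans j≤k le)

-- Splitting off the first variable, f(x₁, x) = f₀(x) + x₁ (f₀(x) + f₁(x)) with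
-- f_b = f(b, ·): the monomials without x₁ are those of f₀, those with x₁
-- are the monomials of f₀ + f₁ multiplied by x₁.
anf-false∷ : ∀ {n m} (f : V (suc n) → V m) u →
  anfCoeff f (false ∷ u) ≡ anfCoeff (λ x → f (false ∷ x)) u
anf-false∷ {n} {m} f u =
  trans (anf-sum f _) (trans (VecSum.∑-suc m n _)
  (trans (cong₂ _⊕_ (sym (anf-sum _ u)) (VecSum.∑-ε m n)) (⊕-identityʳ _)))

anf-true∷ : ∀ {n m} (f : V (suc n) → V m) u →
  anfCoeff f (true ∷ u) ≡ anfCoeff (λ x → f (false ∷ x) ⊕ f (true ∷ x)) u
anf-true∷ {n} {m} f u =
  trans (anf-sum f _) (trans (VecSum.∑-suc m n _)
  (trans (cong₂ _⊕_ (sym (anf-sum _ u)) (sym (anf-sum _ u))) (sym (anf-⊕ _ _ u))))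

Deg<-split : ∀ {n m} (f : V (suc n) → V m) {k} → Deg< f k →
  Deg< (λ x → f (false ∷ x)) k × Deg< (λ x → f (false ∷ x) ⊕ f (true ∷ x)) (k ∸ 1)
Deg<-split f {k} d =
    (λ u le → trans (sym (anf-false∷ f u)) (d (false ∷ u) le))
  , (λ u le → trans (sym (anf-true∷ f u)) (d (true ∷ u) (pred-≤ k le)))
  where
  pred-≤ : ∀ k {w} → k ∸ 1 ≤ w → k ≤ suc w
  pred-≤ zero    _  = z≤n
  pred-≤ (suc k) le = s≤s le

Deg<-join : ∀ {n m} (f : V (suc n) → V m) {k} → Deg< (λ x → f (false ∷ x)) k →
  Deg< (λ x → f (false ∷ x) ⊕ f (true ∷ x)) (k ∸ 1) → Deg< f k
Deg<-join f d₀ d₁ (false ∷ u) le = trans (anf-false∷ f u) (d₀ u le)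
Deg<-join f d₀ d₁ (true ∷ u)  le = trans (anf-true∷ f u) (d₁ u (ℕP.∸-monoˡ-≤ 1 le))

Δ : ∀ {n m} → V n → (V n → V m) → V n → V m
Δ a f x = f x ⊕ f (x ⊕ a)

mutual
  derivative-degree : ∀ n {m} (f : V n → V m) k (a : V n) → Deg< f k → Deg< (Δ a f) (k ∸ 1)
  derivative-degree zero {m} f k [] d u le =
    trans (anf-ext {f = Δ [] f} {g = λ _ → zeroV m} (λ { [] → ⊕-self (f []) }) u) (anf-zero u)
  derivative-degree (suc n) {m} f k (false ∷ a) d =
    Deg<-join (Δ (false ∷ a) f)
      (derivative-degree n f₀ k a d₀)
      (Deg<-ext (λ x → VecSum.interchange m (f₀ x) (f₁ x) (f₀ (x ⊕ a)) (f₁ (x ⊕ a)))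
        (derivative-degree n g (k ∸ 1) a d₁))
    where
    f₀ f₁ g : V n → V m
    f₀ x = f (false ∷ x)
    f₁ x = f (true ∷ x)
    g x = f₀ x ⊕ f₁ x
    d₀ = proj₁ (Deg<-split f d)
    d₁ = proj₂ (Deg<-split f d)
  derivative-degree (suc n) {m} f k (true ∷ a) d =
    Deg<-join (Δ (true ∷ a) f)
      (Deg<-ext (λ x → ⊕-telescope (f₀ x) (f₀ (x ⊕ a)) (f₁ (x ⊕ a)))
        (Deg<-⊕ (derivative-degree n f₀ k a d₀) (translation-degree n g (k ∸ 1) a d₁)))
      (Deg<-ext (λ x → sym (trans (VecSum.interchange m (f₀ x) (f₁ (x ⊕ a)) (f₁ x) (f₀ (x ⊕ a)))
                              (cong ((f₀ x ⊕ f₁ x) ⊕_) (⊕-comm (f₁ (x ⊕ a)) (f₀ (x ⊕ a))))))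
        (derivative-degree n g (k ∸ 1) a d₁))
    where
    f₀ f₁ g : V n → V m
    f₀ x = f (false ∷ x)
    f₁ x = f (true ∷ x)
    g x = f₀ x ⊕ f₁ x
    d₀ = proj₁ (Deg<-split f d)
    d₁ = proj₂ (Deg<-split f d)

  -- f(x + c) = f(x) + Δ_c f(x)
  translation-degree : ∀ n {m} (f : V n → V m) k (c : V n) → Deg< f k → Deg< (λ x → f (x ⊕ c)) k
  translation-degree n f k c d =
    Deg<-ext (λ x → trans (sym (⊕-assoc (f x) (f x) (f (x ⊕ c))))
                         (trans (cong (_⊕ f (x ⊕ c)) (⊕-self (f x))) (⊕-identityˡ _)))
      (Deg<-⊕ d (Deg<-mono (ℕP.m∸n≤m k 1) (derivative-degree n f k c d)))

Deg<0⇒zero : ∀ n {m} (h : V n → V m) → Deg< h 0 → ∀ x → h x ≡ zeroV m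
Deg<0⇒zero zero    h d []          = trans (sym (⊕-identityʳ (h []))) (d [] z≤n)
Deg<0⇒zero (suc n) h d (false ∷ x) = Deg<0⇒zero n _ (proj₁ (Deg<-split h d)) x
Deg<0⇒zero (suc n) h d (true ∷ x)  =
  trans (sym (⊕≡0⇒≡ _ _ (Deg<0⇒zero n _ (proj₂ (Deg<-split h d)) x)))
        (Deg<0⇒zero n _ (proj₁ (Deg<-split h d)) x)

Deg<2⇒affine : ∀ n {m} (f : V n → V m) → Deg< f 2 → ∀ x y → f (x ⊕ y) ⊕ f (zeroV n) ≡ f x ⊕ f y
Deg<2⇒affine n {m} f d x y = ⊕≡0⇒≡ (S ⊕ P) (R ⊕ Q) (begin
  (S ⊕ P) ⊕ (R ⊕ Q)  ≡⟨ cong₂ _⊕_ (⊕-comm S P) (⊕-comm R Q) ⟩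
  (P ⊕ S) ⊕ (Q ⊕ R)  ≡⟨ VecSum.interchange m P S Q R ⟩
  (P ⊕ Q) ⊕ (S ⊕ R)  ≡⟨ cong ((P ⊕ Q) ⊕_) (⊕-comm S R) ⟩
  (P ⊕ Q) ⊕ (R ⊕ S)  ≡⟨ second-derivative ⟩
  zeroV m            ∎)
  where
  open ≡-Reasoning
  P = f (zeroV n)
  Q = f y
  R = f x
  S = f (x ⊕ y)
  -- Δ_x Δ_y f has degree < 0, so it vanishes at 0
  second-derivative : (P ⊕ Q) ⊕ (R ⊕ S) ≡ zeroV m
  second-derivative =
    trans (sym (cong₂ (λ b c → (P ⊕ f b) ⊕ (f c ⊕ f (c ⊕ y))) (⊕-identityˡ y) (⊕-identityˡ x)))
          (Deg<0⇒zero n _ (derivative-degree n _ 1 x (derivative-degree n f 2 y d)) (zeroV n))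

quadratic⇒Deg<3 : ∀ {n} (F : V n → V n) → Quadratic F → Deg< F 3
quadratic⇒Deg<3 {n} F q u 3≤wt with isZero (anfCoeff F u) in coeff
... | true  = isZero-sound _ coeff
... | false = ⊥-elim (3≰2 (subst (3 ≤_) q (ℕP.≤-trans 3≤wt wt≤deg)))
  where
  3≰2 : ¬ (3 ≤ 2)
  3≰2 (s≤s (s≤s ()))
  term : V n → ℕ
  term u = if isZero (anfCoeff F u) then 0 else wt u
  bound : ∀ {xs} → u ∈ xs → term u ≤ foldr (λ u d → term u ⊔ d) 0 xs
  bound (here refl) = ℕP.m≤m⊔n _ _
  bound {y ∷ _} (there u∈xs) = ℕP.m≤n⇒m≤o⊔n (term y) (bound u∈xs)
  wt≤deg : wt u ≤ algDeg F
  wt≤deg = subst (λ b → (if b then 0 else wt u) ≤ algDeg F) coeff (bound (allV-complete n u))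

-- Character sums on 𝔽₂ⁿ

sign : Bool → ℤ
sign false = 1ℤ
sign true  = -1ℤ

sign-xor : ∀ p q → sign (p xor q) ≡ sign p *ℤ sign q
sign-xor true  true  = refl
sign-xor true  false = refl
sign-xor false true  = refl
sign-xor false false = refl

sign-flip : ∀ p → sign (p xor true) ≡ - sign p
sign-flip true  = refl
sign-flip false = refl

indZ : Bool → ℤ
indZ true  = 1ℤ
indZ false = 0ℤ

2^ : ℕ → ℤ
2^ n = + (2 ^ n)

2^[_]_ : Bool → ℕ → ℤ
2^[ b ] n = if b then 2^ n else 0ℤ

2^-suc : ∀ n → 2^ n +ℤ 2^ n ≡ 2^ (suc n)
2^-suc n = trans (sym (ℤP.pos-+ (2 ^ n) (2 ^ n)))
                 (cong (λ k → + (2 ^ n ℕ.+ k)) (sym (ℕP.+-identityʳ (2 ^ n))))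

∑-neg : ∀ n (f : V n → ℤ) → - IntSum.∑ n f ≡ IntSum.∑ n (λ x → - f x)
∑-neg n f = sumL-hom -_ refl ℤP.neg-distrib-+ f (allV n)

∑-scale : ∀ n (c : ℤ) (f : V n → ℤ) → c *ℤ IntSum.∑ n f ≡ IntSum.∑ n (λ x → c *ℤ f x)
∑-scale n c f = sumL-hom (c *ℤ_) (ℤP.*-zeroʳ c) (ℤP.*-distribˡ-+ c) f (allV n)

∑-const1 : ∀ n → IntSum.∑ n (λ _ → 1ℤ) ≡ 2^ n
∑-const1 zero    = refl
∑-const1 (suc n) = trans (IntSum.∑-suc n _) (trans (cong₂ _+ℤ_ (∑-const1 n) (∑-const1 n)) (2^-suc n))

count-∑ℤ : ∀ n (p : V n → Bool) → + countV n p ≡ IntSum.∑ n (λ x → indZ (p x))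
count-∑ℤ n p =
  trans (cong +_ (countV-sum n p))
  (trans (sumL-hom +_ refl ℤP.pos-+ (λ x → indN (p x)) (allV n))
         (IntSum.∑-ext n (λ x → indN-indZ (p x))))
  where
  indN-indZ : ∀ b → + indN b ≡ indZ b
  indN-indZ true  = refl
  indN-indZ false = refl

self-neg : ∀ i → i ≡ - i → i ≡ 0ℤ
self-neg (+ zero) _ = refl

orthogonality : ∀ n (y : V n) → IntSum.∑ n (λ v → sign (v · y)) ≡ 2^[ isZero y ] n
orthogonality zero    []          = refl
orthogonality (suc n) (false ∷ y) =
  trans (IntSum.∑-suc n _) (trans (cong₂ _+ℤ_ (orthogonality n y) (orthogonality n y)) (double (isZero y)))
  where
  double : ∀ b → 2^[ b ] n +ℤ 2^[ b ] n ≡ 2^[ b ] (suc n)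
  double true  = 2^-suc n
  double false = refl
orthogonality (suc n) (true ∷ y) =
  trans (IntSum.∑-suc n _)
  (trans (cong (S +ℤ_) (trans (IntSum.∑-ext n (λ v → trans (cong sign (xor-comm true (v · y)))
                                                              (sign-flip (v · y))))
                               (sym (∑-neg n _))))
         (ℤP.+-inverseʳ S))
  where
  S = IntSum.∑ n (λ v → sign (v · y))

module CharacterSums {n : ℕ} (L : V n → V n) (L-linear : ∀ x y → L (x ⊕ y) ≡ L x ⊕ L y) where

  annihilates : V n → Bool
  annihilates v = allV? n (λ x → not (v · L x))

  -- Σ_x (−1)^{v · L x} = 2ⁿ [v annihilates Im L]: otherwise translating by
  -- some x₀ with v · L x₀ = 1 negates the sum.
  character-sum : ∀ v → IntSum.∑ n (λ x → sign (v · L x)) ≡ 2^[ annihilates v ] n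
  character-sum v with annihilates v in ann
  ... | true = trans (IntSum.∑-ext n (λ x → cong sign (vanishes x))) (∑-const1 n)
    where
    vanishes : ∀ x → v · L x ≡ false
    vanishes x with v · L x | allV-elim n (λ x → not (v · L x)) ann x
    ... | false | _ = refl
  ... | false with allV-false n (λ x → not (v · L x)) ann
  ... | x₀ , vLx₀ = self-neg S (trans (sym (IntSum.∑-translate n f x₀))
                                      (trans (IntSum.∑-ext n negated) (sym (∑-neg n f))))
    where
    f : V n → ℤ
    f x = sign (v · L x)
    S = IntSum.∑ n f
    v·Lx₀ : v · L x₀ ≡ true
    v·Lx₀ = trans (sym (not-involutive _)) (cong not vLx₀)
    negated : ∀ x → f (x ⊕ x₀) ≡ - f x
    negated x = begin
      sign (v · L (x ⊕ x₀))         ≡⟨ cong (λ z → sign (v · z)) (L-linear x x₀) ⟩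
      sign (v · (L x ⊕ L x₀))       ≡⟨ cong sign (·-⊕ v (L x) (L x₀)) ⟩
      sign ((v · L x) xor v · L x₀) ≡⟨ cong (λ b → sign ((v · L x) xor b)) v·Lx₀ ⟩
      sign ((v · L x) xor true)     ≡⟨ sign-flip (v · L x) ⟩
      - f x                         ∎
      where open ≡-Reasoning

  preimage-count : ∀ y →
    + countV n (λ x → eqV (L x) y) ≡ IntSum.∑ n (λ v → indZ (annihilates v) *ℤ sign (v · y))
  preimage-count y = ℤP.*-cancelˡ-≡ (2^ n) _ _ {{ℕP.m^n≢0 2 n}} (begin
    2^ n *ℤ + countV n (λ x → eqV (L x) y)
      ≡⟨ cong (2^ n *ℤ_) (count-∑ℤ n _) ⟩
    2^ n *ℤ IntSum.∑ n (λ x → indZ (eqV (L x) y))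
      ≡⟨ ∑-scale n (2^ n) _ ⟩
    IntSum.∑ n (λ x → 2^ n *ℤ indZ (eqV (L x) y))
      ≡⟨ IntSum.∑-ext n expand ⟩
    IntSum.∑ n (λ x → IntSum.∑ n (λ v → sign (v · L x) *ℤ sign (v · y)))
      ≡⟨ IntSum.∑-swap n n _ ⟩
    IntSum.∑ n (λ v → IntSum.∑ n (λ x → sign (v · L x) *ℤ sign (v · y)))
      ≡⟨ IntSum.∑-ext n collapse ⟩
    IntSum.∑ n (λ v → 2^ n *ℤ (indZ (annihilates v) *ℤ sign (v · y)))
      ≡⟨ sym (∑-scale n (2^ n) _) ⟩
    2^ n *ℤ IntSum.∑ n (λ v → indZ (annihilates v) *ℤ sign (v · y))  ∎)
    where
    open ≡-Reasoning
    2^-indZ : ∀ b → 2^ n *ℤ indZ b ≡ 2^[ b ] n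
    2^-indZ true  = ℤP.*-identityʳ (2^ n)
    2^-indZ false = ℤP.*-zeroʳ (2^ n)

    expand : ∀ x → 2^ n *ℤ indZ (eqV (L x) y) ≡ IntSum.∑ n (λ v → sign (v · L x) *ℤ sign (v · y))
    expand x =
      trans (2^-indZ _)
      (trans (cong (λ b → 2^[ b ] n) (eqV-⊕ (L x) y))
      (trans (sym (orthogonality n (L x ⊕ y)))
             (IntSum.∑-ext n (λ v → trans (cong sign (·-⊕ v (L x) y)) (sign-xor (v · L x) (v · y))))))

    collapse : ∀ v → IntSum.∑ n (λ x → sign (v · L x) *ℤ sign (v · y))
                   ≡ 2^ n *ℤ (indZ (annihilates v) *ℤ sign (v · y))
    collapse v =
      trans (IntSum.∑-ext n (λ x → ℤP.*-comm (sign (v · L x)) (sign (v · y))))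
      (trans (sym (∑-scale n (sign (v · y)) _))
      (trans (ℤP.*-comm (sign (v · y)) _)
      (trans (cong (_*ℤ sign (v · y)) (trans (character-sum v) (sym (2^-indZ (annihilates v)))))
             (ℤP.*-assoc (2^ n) _ _))))

-- Linear maps with a two-element kernel

-- If the kernel of a linear endomorphism L of 𝔽₂ⁿ has exactly two elements,
-- then the annihilator of Im L is {0, u} for a single u ≠ 0, and
-- Im L = u^⊥ = { y : u · y = 0 }.
module TwoElementKernel {n : ℕ} (L : V n → V n) (L-linear : ∀ x y → L (x ⊕ y) ≡ L x ⊕ L y)
  (kernel₂ : countV n (λ x → eqV (L x) (zeroV n)) ≡ 2) where

  open CharacterSums L L-linear public

  -- the annihilator has as many elements as the kernel (take y = 0 above)
  annihilator₂ : countV n annihilates ≡ 2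
  annihilator₂ = ℤP.+-injective (begin
    + countV n annihilates
      ≡⟨ count-∑ℤ n annihilates ⟩
    IntSum.∑ n (λ v → indZ (annihilates v))
      ≡⟨ IntSum.∑-ext n (λ v → sym (trans (cong (λ b → indZ (annihilates v) *ℤ sign b) (·-zeroʳ v))
                                          (ℤP.*-identityʳ _))) ⟩
    IntSum.∑ n (λ v → indZ (annihilates v) *ℤ sign (v · zeroV n))
      ≡⟨ sym (preimage-count (zeroV n)) ⟩
    + countV n (λ x → eqV (L x) (zeroV n))
      ≡⟨ cong +_ kernel₂ ⟩
    + 2 ∎)
    where open ≡-Reasoning

  annihilates-zero : annihilates (zeroV n) ≡ true
  annihilates-zero = allV-intro n _ (λ x → cong not (·-zeroˡ (L x)))

  -- Kept abstract: only the stated properties of u matter, and unfolding the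
  -- witness produced by the counting argument is expensive.
  abstract
    normal : Σ[ u ∈ V n ] ¬ (u ≡ zeroV n) × annihilates u ≡ true ×
               (∀ v → annihilates v ≡ true → (v ≡ zeroV n) ⊎ (v ≡ u))
    normal = count≡2 n annihilates (zeroV n) annihilator₂ annihilates-zero

  u : V n
  u = proj₁ normal

  u≢0 : ¬ (u ≡ zeroV n)
  u≢0 = proj₁ (proj₂ normal)

  annihilates-u : annihilates u ≡ true
  annihilates-u = proj₁ (proj₂ (proj₂ normal))

  annihilator : ∀ v → annihilates v ≡ true → (v ≡ zeroV n) ⊎ (v ≡ u)
  annihilator = proj₂ (proj₂ (proj₂ normal))

  u-orthogonal : ∀ x → u · L x ≡ false
  u-orthogonal x = trans (sym (not-involutive _)) (cong not (allV-elim n _ annihilates-u x))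

  -- Every y ∈ u^⊥ has 1 + (−1)^{u·y} = 2 preimages, in particular one.
  image : ∀ y → u · y ≡ false → Σ[ x ∈ V n ] L x ≡ y
  image y u·y = x , eqV-sound (L x) y Lx≡y
    where
    only-0-and-u : ∀ v → indZ (annihilates v) *ℤ sign (v · y)
      ≡ (if eqV v (zeroV n) then sign (v · y) else 0ℤ) +ℤ (if eqV v u then sign (v · y) else 0ℤ)
    only-0-and-u v with annihilates v in ann | eqV v (zeroV n) in v0 | eqV v u in vu
    ... | true  | true  | true  = ⊥-elim (u≢0 (trans (sym (eqV-sound v u vu)) (eqV-sound v _ v0)))
    ... | true  | true  | false = trans (ℤP.*-identityˡ _) (sym (ℤP.+-identityʳ _))
    ... | true  | false | true  = trans (ℤP.*-identityˡ _) (sym (ℤP.+-identityˡ _))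
    ... | true  | false | false with annihilator v ann
    ...   | inj₁ refl = ⊥-elim (true≢false (trans (sym (eqV-refl v)) v0))
    ...   | inj₂ refl = ⊥-elim (true≢false (trans (sym (eqV-refl v)) vu))
    only-0-and-u v | false | true | _ =
      ⊥-elim (true≢false (trans (sym annihilates-zero) (trans (cong annihilates (sym (eqV-sound v _ v0))) ann)))
    only-0-and-u v | false | false | true =
      ⊥-elim (true≢false (trans (sym annihilates-u) (trans (cong annihilates (sym (eqV-sound v u vu))) ann)))
    only-0-and-u v | false | false | false = refl

    two-preimages : countV n (λ x → eqV (L x) y) ≡ 2
    two-preimages = ℤP.+-injective (begin
      + countV n (λ x → eqV (L x) y)
        ≡⟨ preimage-count y ⟩
      IntSum.∑ n (λ v → indZ (annihilates v) *ℤ sign (v · y))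
        ≡⟨ IntSum.∑-ext n only-0-and-u ⟩
      IntSum.∑ n (λ v → (if eqV v (zeroV n) then sign (v · y) else 0ℤ)
                         +ℤ (if eqV v u then sign (v · y) else 0ℤ))
        ≡⟨ IntSum.∑-∙ n _ _ ⟩
      IntSum.∑ n (λ v → if eqV v (zeroV n) then sign (v · y) else 0ℤ)
        +ℤ IntSum.∑ n (λ v → if eqV v u then sign (v · y) else 0ℤ)
        ≡⟨ cong₂ _+ℤ_ (IntSum.∑-delta n (λ v → sign (v · y)) (zeroV n))
                   (IntSum.∑-delta n (λ v → sign (v · y)) u) ⟩
      sign (zeroV n · y) +ℤ sign (u · y)
        ≡⟨ cong₂ (λ b c → sign b +ℤ sign c) (·-zeroˡ y) u·y ⟩
      + 2 ∎)
      where open ≡-Reasoning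

    x : V n
    x = proj₁ (count-pos n (λ x → eqV (L x) y) two-preimages)

    Lx≡y : eqV (L x) y ≡ true
    Lx≡y = proj₂ (count-pos n (λ x → eqV (L x) y) two-preimages)

constant-derivative : ∀ {n} (F : V n → V n) (y a : V n) → Bool
constant-derivative {n} F y a = allV? n (λ x → eqB (y · Δ a F x) (y · Δ a F (zeroV n)))

-- D_a F(x) = L(x) + D_a F(0) with L linear and ker L = {0, a}; hence
-- B_a(F) = u^⊥ + D_a F(0) for the normal u of Im L, and Φ_F(a) = u.
module PhiAtNonzero {n : ℕ} (F : V n → V n) (quadratic : Quadratic F) (apn : APN F)
  (a : V n) (a≢0 : ¬ (a ≡ zeroV n)) where

  D : V n → V n
  D = Δ a F

  L : V n → V n
  L x = D x ⊕ D (zeroV n)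

  L-linear : ∀ x y → L (x ⊕ y) ≡ L x ⊕ L y
  L-linear x y = begin
    D (x ⊕ y) ⊕ D₀           ≡⟨ Deg<2⇒affine n D (derivative-degree n F 3 a (quadratic⇒Deg<3 F quadratic)) x y ⟩
    D x ⊕ D y                ≡⟨ cong (_⊕ D y) (sym (⊕-cancelʳ (D x) D₀)) ⟩
    ((D x ⊕ D₀) ⊕ D₀) ⊕ D y  ≡⟨ ⊕-assoc (D x ⊕ D₀) D₀ (D y) ⟩
    (D x ⊕ D₀) ⊕ (D₀ ⊕ D y)  ≡⟨ cong ((D x ⊕ D₀) ⊕_) (⊕-comm D₀ (D y)) ⟩
    (D x ⊕ D₀) ⊕ (D y ⊕ D₀)  ∎
    where
    open ≡-Reasoning
    D₀ = D (zeroV n)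

  -- APN: at most two x have D x = D 0, and x = 0, x = a are two of them.
  kernel₂ : countV n (λ x → eqV (L x) (zeroV n)) ≡ 2
  kernel₂ = ℕP.≤-antisym at-most-2 (count≥2 n _ (zeroV n) a a≢0 (in-kernel L0) (in-kernel La))
    where
    at-most-2 : countV n (λ x → eqV (L x) (zeroV n)) ≤ 2
    at-most-2 = subst (_≤ 2) (countV-ext n (λ x → eqV-⊕ (D x) (D (zeroV n)))) (apn a (D (zeroV n)) a≢0)
    in-kernel : ∀ {x} → L x ≡ zeroV n → eqV (L x) (zeroV n) ≡ true
    in-kernel {x} Lx≡0 = trans (cong (λ z → eqV z (zeroV n)) Lx≡0) (eqV-refl (zeroV n))
    L0 : L (zeroV n) ≡ zeroV n
    L0 = ⊕-self (D (zeroV n))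
    La : L a ≡ zeroV n
    La = trans (cong₂ (λ z w → (F a ⊕ F z) ⊕ (F (zeroV n) ⊕ F w)) (⊕-self a) (⊕-identityˡ a))
               (trans (cong ((F a ⊕ F (zeroV n)) ⊕_) (⊕-comm (F (zeroV n)) (F a))) (⊕-self _))

  open TwoElementKernel L L-linear kernel₂

  c : Bool
  c = u · D (zeroV n)

  D≡L+D₀ : ∀ x → D x ≡ L x ⊕ D (zeroV n)
  D≡L+D₀ x = sym (⊕-cancelʳ (D x) (D (zeroV n)))

  u·D : ∀ x → u · D x ≡ c
  u·D x = trans (cong (u ·_) (D≡L+D₀ x))
                (trans (·-⊕ u (L x) (D (zeroV n))) (cong (_xor c) (u-orthogonal x)))

  describes⇒on-D : ∀ w b → describes F a w b ≡ true → ∀ x → w · D x ≡ b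
  describes⇒on-D w b desc x = eqB-sound _ _ (subst (λ z → z ≡ true) (eqB-sound _ _ at-Dx) Dx∈B)
    where
    Dx∈B : inB F a (D x) ≡ true
    Dx∈B = anyV-intro n (λ x′ → eqV (F x′ ⊕ F (x′ ⊕ a)) (D x)) x (eqV-refl (D x))
    at-Dx : eqB (inB F a (D x)) (eqB (w · D x) b) ≡ true
    at-Dx = allV-elim n _ (proj₂ (∧≡true {not (isZero w)} desc)) (D x)

  describes-unique : ∀ w b → describes F a w b ≡ true → (w ≡ u) × (b ≡ c)
  describes-unique w b desc = w≡u , trans (sym (describes⇒on-D w b desc (zeroV n)))
                                          (cong (_· D (zeroV n)) w≡u)
    where
    w≢0 : ¬ (w ≡ zeroV n)
    w≢0 = isZero-false w (trans (sym (not-involutive _)) (cong not (proj₁ (∧≡true desc))))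
    w-annihilates : annihilates w ≡ true
    w-annihilates = allV-intro n _ (λ x → cong not
      (trans (·-⊕ w (D x) (D (zeroV n)))
             (trans (cong₂ _xor_ (describes⇒on-D w b desc x) (describes⇒on-D w b desc (zeroV n)))
                    (xor-same b))))
    w≡u : w ≡ u
    w≡u = fromInj₂ (λ w≡0 → ⊥-elim (w≢0 w≡0)) (annihilator w w-annihilates)

  describes-u : describes F a u c ≡ true
  describes-u = cong₂ _∧_ (cong not (eqV-false u (zeroV n) u≢0))
                          (allV-intro n _ (λ y → eqB-intro (in-B⇒ y) (⇒in-B y)))
    where
    in-B⇒ : ∀ y → inB F a y ≡ true → eqB (u · y) c ≡ true
    in-B⇒ y y∈B =
      trans (cong (λ z → eqB (u · z) c) (sym (eqV-sound _ _ (proj₂ witness))))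
            (trans (cong (λ z → eqB z c) (u·D (proj₁ witness))) (eqB-refl c))
      where
      witness : Σ[ x ∈ V n ] eqV (D x) y ≡ true
      witness = anyV-elim n (λ x → eqV (D x) y) y∈B
    -- y ∈ u^⊥ + D 0, so y + D 0 = L x and y = D x for some x
    ⇒in-B : ∀ y → eqB (u · y) c ≡ true → inB F a y ≡ true
    ⇒in-B y u·y≡c = anyV-intro n (λ x′ → eqV (D x′) y) x (trans (cong (λ z → eqV z y) Dx≡y) (eqV-refl y))
      where
      D₀ = D (zeroV n)
      preimage : Σ[ x ∈ V n ] L x ≡ y ⊕ D₀
      preimage = image (y ⊕ D₀) (trans (·-⊕ u y D₀)
                                 (trans (cong (_xor c) (eqB-sound (u · y) c u·y≡c)) (xor-same c)))
      x : V n
      x = proj₁ preimage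
      Dx≡y : D x ≡ y
      Dx≡y = trans (D≡L+D₀ x) (trans (cong (_⊕ D₀) (proj₂ preimage)) (⊕-cancelʳ y D₀))

  Φ≡u : Φ F a ≡ u
  Φ≡u = trans (cong (λ b → if b then zeroV n else findFirst described (zeroV n) (allV n))
                    (eqV-false a (zeroV n) a≢0))
              (findFirst-unique described (zeroV n) u (allV n) (allV-complete n u)
                                (described-intro c describes-u) described-unique)
    where
    described : V n → Bool
    described w = describes F a w false ∨ describes F a w true
    described-intro : ∀ b → describes F a u b ≡ true → described u ≡ true
    described-intro false d = cong (_∨ describes F a u true) d
    described-intro true  d = trans (cong (describes F a u false ∨_) d) (∨-zeroʳ _)
    described-unique : ∀ w → described w ≡ true → w ≡ u
    described-unique w d with describes F a w false in d₀
    ... | true  = proj₁ (describes-unique w false d₀)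
    ... | false = proj₁ (describes-unique w true d)

  Φ-nonzero : isZero (Φ F a) ≡ false
  Φ-nonzero = trans (cong isZero Φ≡u) (eqV-false u (zeroV n) u≢0)

  Φ≡y-iff : ∀ y → ¬ (y ≡ zeroV n) → eqV (Φ F a) y ≡ constant-derivative F y a
  Φ≡y-iff y y≢0 = trans (cong (λ z → eqV z y) Φ≡u) (bool-iff u≡y⇒ ⇒u≡y)
    where
    u≡y⇒ : eqV u y ≡ true → constant-derivative F y a ≡ true
    u≡y⇒ e = subst (λ z → constant-derivative F z a ≡ true) (eqV-sound u y e)
      (allV-intro n _ (λ x → trans (cong (λ b → eqB b c) (u·D x)) (eqB-refl c)))
    -- if y · D is constant then y annihilates Im L, so y ∈ {0, u}
    ⇒u≡y : constant-derivative F y a ≡ true → eqV u y ≡ true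
    ⇒u≡y const = trans (cong (eqV u) y≡u) (eqV-refl u)
      where
      y-annihilates : annihilates y ≡ true
      y-annihilates = allV-intro n _ (λ x → cong not (trans (·-⊕ y (D x) (D (zeroV n)))
        (≡⇒xor≡false {y · D x} (eqB-sound _ _ (allV-elim n _ const x)))))
      y≡u : y ≡ u
      y≡u = fromInj₂ (λ y≡0 → ⊥-elim (y≢0 y≡0)) (annihilator y y-annihilates)

Δ-⊕ : ∀ {n m} (f : V n → V m) a b x → Δ (a ⊕ b) f x ≡ Δ a f x ⊕ Δ b f (x ⊕ a)
Δ-⊕ f a b x = sym (trans (⊕-telescope (f x) (f (x ⊕ a)) (f ((x ⊕ a) ⊕ b)))
                         (cong (λ z → f x ⊕ f z) (⊕-assoc x a b)))

module ConstantDerivatives {n : ℕ} (F : V n → V n) (y : V n) where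

  private
    constant : V n → Bool
    constant = constant-derivative F y

    constant-sound : ∀ a → constant a ≡ true → ∀ x → y · Δ a F x ≡ y · Δ a F (zeroV n)
    constant-sound a e x = eqB-sound _ _ (allV-elim n _ e x)

    constant-intro : ∀ a → (∀ x → y · Δ a F x ≡ y · Δ a F (zeroV n)) → constant a ≡ true
    constant-intro a h =
      allV-intro n _ (λ x → trans (cong (λ b → eqB b _) (h x)) (eqB-refl (y · Δ a F (zeroV n))))

  constant-zero : constant (zeroV n) ≡ true
  constant-zero = constant-intro (zeroV n) (λ x → trans (vanishes x) (sym (vanishes (zeroV n))))
    where
    vanishes : ∀ x → y · Δ (zeroV n) F x ≡ false
    vanishes x = trans (cong (λ z → y · (F x ⊕ F z)) (⊕-identityʳ x))
                       (trans (cong (y ·_) (⊕-self (F x))) (·-zeroʳ y))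

  constant-⊕ : ∀ a b → constant a ≡ true → constant b ≡ true → constant (a ⊕ b) ≡ true
  constant-⊕ a b ca cb = constant-intro (a ⊕ b) (λ x → trans (value x) (sym (value (zeroV n))))
    where
    value : ∀ x → y · Δ (a ⊕ b) F x ≡ (y · Δ a F (zeroV n)) xor (y · Δ b F (zeroV n))
    value x = trans (cong (y ·_) (Δ-⊕ F a b x))
              (trans (·-⊕ y _ _) (cong₂ _xor_ (constant-sound a ca x) (constant-sound b cb (x ⊕ a))))

  constant-translate : ∀ c → constant c ≡ true → ∀ a → constant (a ⊕ c) ≡ constant a
  constant-translate c cc a = bool-iff
    (λ e → subst (λ z → constant z ≡ true) (⊕-cancelʳ a c) (constant-⊕ (a ⊕ c) c e cc))
    (λ e → constant-⊕ a c e cc)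

-- A Boolean function invariant under translation by some c ≠ 0 has even
-- weight: 𝔽₂ⁿ splits into the pairs {a, a + c}.
translation-invariant⇒even : ∀ n (P : V n → Bool) (c : V n) → ¬ (c ≡ zeroV n) →
  (∀ a → P (a ⊕ c) ≡ P a) → ParSum.∑ n P ≡ false
translation-invariant⇒even zero    P []          c≢0 inv = ⊥-elim (c≢0 refl)
translation-invariant⇒even (suc n) P (false ∷ c) c≢0 inv =
  trans (ParSum.∑-suc n P) (cong₂ _xor_
    (translation-invariant⇒even n (λ a → P (false ∷ a)) c c≢0′ (λ a → inv (false ∷ a)))
    (translation-invariant⇒even n (λ a → P (true ∷ a)) c c≢0′ (λ a → inv (true ∷ a))))
  where
  c≢0′ : ¬ (c ≡ zeroV n)
  c≢0′ c≡0 = c≢0 (cong (false ∷_) c≡0)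
translation-invariant⇒even (suc n) P (true ∷ c) c≢0 inv =
  trans (ParSum.∑-suc n P)
  (trans (cong (_xor ParSum.∑ n P₁)
           (trans (ParSum.∑-ext n (λ a → sym (inv (false ∷ a)))) (ParSum.∑-translate n P₁ c)))
         (xor-same (ParSum.∑ n P₁)))
  where
  P₁ : V n → Bool
  P₁ a = P (true ∷ a)

zero-count-odd : ∀ n → ParSum.∑ n isZero ≡ true
zero-count-odd n = trans (ParSum.∑-ext n (λ a → if-id (isZero a))) (ParSum.∑-delta n (λ _ → true) (zeroV n))
  where
  if-id : ∀ b → b ≡ (if b then true else false)
  if-id true  = refl
  if-id false = refl

nonzero-count-odd : ∀ n → n ≥ 1 → ParSum.∑ n (λ a → not (isZero a)) ≡ true
nonzero-count-odd (suc n) _ =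
  trans (ParSum.∑-ext n′ (λ a → sym (true-xor (isZero a))))
  (trans (ParSum.∑-∙ n′ _ _)
         (cong₂ _xor_ (trans (ParSum.∑-suc n _) (xor-same (ParSum.∑ n (λ _ → true)))) (zero-count-odd n′)))
  where
  n′ = suc n

image-parity : ∀ n (φ : V n → V n) →
  (∀ y → ¬ (y ≡ zeroV n) → anyV n (λ a → eqV (φ a) y) ≡ ParSum.∑ n (λ a → eqV (φ a) y)) →
  ParSum.∑ n (λ y → not (isZero y) ∧ anyV n (λ a → eqV (φ a) y)) ≡ ParSum.∑ n (λ a → not (isZero (φ a)))
image-parity n φ fibre = begin
  ParSum.∑ n (λ y → not (isZero y) ∧ anyV n (λ a → eqV (φ a) y))
    ≡⟨ ParSum.∑-ext n fibre-sum ⟩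
  ParSum.∑ n (λ y → ParSum.∑ n (λ a → not (isZero y) ∧ eqV (φ a) y))
    ≡⟨ ParSum.∑-swap n n _ ⟩
  ParSum.∑ n (λ a → ParSum.∑ n (λ y → not (isZero y) ∧ eqV (φ a) y))
    ≡⟨ ParSum.∑-ext n (λ a → trans (ParSum.∑-ext n (as-delta a)) (ParSum.∑-delta n _ (φ a))) ⟩
  ParSum.∑ n (λ a → not (isZero (φ a)))  ∎
  where
  open ≡-Reasoning
  fibre-sum : ∀ y → not (isZero y) ∧ anyV n (λ a → eqV (φ a) y)
                  ≡ ParSum.∑ n (λ a → not (isZero y) ∧ eqV (φ a) y)
  fibre-sum y with isZero y in y0
  ... | true  = sym (ParSum.∑-ε n)
  ... | false = fibre y (isZero-false y y0)
  as-delta : ∀ a y → not (isZero y) ∧ eqV (φ a) y ≡ (if eqV y (φ a) then not (isZero y) else false)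
  as-delta a y rewrite eqV-comm (φ a) y with eqV y (φ a)
  ... | true  = ∧-identityʳ _
  ... | false = ∧-zeroʳ _

module _ {n : ℕ} (F : V n → V n) (quadratic : Quadratic F) (apn : APN F) where

  Φ-zero : Φ F (zeroV n) ≡ zeroV n
  Φ-zero rewrite isZero-zero n = refl

  isZero-Φ : ∀ a → isZero (Φ F a) ≡ isZero a
  isZero-Φ a = by-cases (isZero a) refl
    where
    by-cases : ∀ b → isZero a ≡ b → isZero (Φ F a) ≡ isZero a
    by-cases true  a0 = trans (cong (λ z → isZero (Φ F z)) (isZero-sound a a0))
                        (trans (cong isZero Φ-zero) (trans (isZero-zero n) (sym a0)))
    by-cases false a0 = trans (PhiAtNonzero.Φ-nonzero F quadratic apn a (isZero-false a a0)) (sym a0)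

  Φ≡y-iff-nonzero : ∀ y → ¬ (y ≡ zeroV n) → ∀ a →
    eqV (Φ F a) y ≡ constant-derivative F y a xor isZero a
  Φ≡y-iff-nonzero y y≢0 a = by-cases (isZero a) refl
    where
    by-cases : ∀ b → isZero a ≡ b → eqV (Φ F a) y ≡ constant-derivative F y a xor b
    by-cases false a0 = trans (PhiAtNonzero.Φ≡y-iff F quadratic apn a (isZero-false a a0) y y≢0)
                              (sym (xor-identityʳ _))
    by-cases true  a0 = begin
      eqV (Φ F a) y                                      ≡⟨ cong (λ z → eqV (Φ F z) y) a≡0 ⟩
      eqV (Φ F (zeroV n)) y                              ≡⟨ cong (λ z → eqV z y) Φ-zero ⟩
      eqV (zeroV n) y                                    ≡⟨ eqV-false (zeroV n) y (λ 0≡y → y≢0 (sym 0≡y)) ⟩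
      false                                              ≡⟨ cong (_xor true) (sym (ConstantDerivatives.constant-zero F y)) ⟩
      constant-derivative F y (zeroV n) xor true         ≡⟨ cong (λ z → constant-derivative F y z xor true) (sym a≡0) ⟩
      constant-derivative F y a xor true                 ∎
      where
      open ≡-Reasoning
      a≡0 : a ≡ zeroV n
      a≡0 = isZero-sound a a0

  -- Each nonzero fibre of Φ_F is empty or has odd size: if a₀ ≠ 0 lies in
  -- it, then S_y ∋ a₀ is invariant under translation by a₀, hence even.
  fibre-parity : ∀ y → ¬ (y ≡ zeroV n) →
    anyV n (λ a → eqV (Φ F a) y) ≡ ParSum.∑ n (λ a → eqV (Φ F a) y)
  fibre-parity y y≢0 with anyV n (λ a → eqV (Φ F a) y) in nonempty
  ... | false = sym (trans (ParSum.∑-ext n not-hit) (ParSum.∑-ε n))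
    where
    not-hit : ∀ a → eqV (Φ F a) y ≡ false
    not-hit a with eqV (Φ F a) y in hit
    ... | false = refl
    ... | true  = ⊥-elim (true≢false (trans (sym (anyV-intro n _ a hit)) nonempty))
  ... | true with anyV-elim n _ nonempty
  ...   | a₀ , Φa₀≡y = sym (begin
    ParSum.∑ n (λ a → eqV (Φ F a) y)
      ≡⟨ ParSum.∑-ext n (Φ≡y-iff-nonzero y y≢0) ⟩
    ParSum.∑ n (λ a → constant-derivative F y a xor isZero a)
      ≡⟨ ParSum.∑-∙ n _ _ ⟩
    ParSum.∑ n (constant-derivative F y) xor ParSum.∑ n isZero
      ≡⟨ cong₂ _xor_ (translation-invariant⇒even n _ a₀ a₀≢0
                        (ConstantDerivatives.constant-translate F y a₀ a₀∈S))
                     (zero-count-odd n) ⟩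
    true ∎)
    where
    open ≡-Reasoning
    a₀≢0 : ¬ (a₀ ≡ zeroV n)
    a₀≢0 refl = y≢0 (sym (eqV-sound _ _ (trans (cong (λ z → eqV z y) (sym Φ-zero)) Φa₀≡y)))
    a₀∈S : constant-derivative F y a₀ ≡ true
    a₀∈S = trans (sym (xor-identityʳ _))
           (trans (cong (constant-derivative F y a₀ xor_) (sym (eqV-false a₀ (zeroV n) a₀≢0)))
           (trans (sym (Φ≡y-iff-nonzero y y≢0 a₀)) Φa₀≡y))

corollary1 : (n : ℕ) → n ≥ 1 → (F : V n → V n) → Quadratic F → APN F →
    nonzeroImageSize F % 2 ≡ 1
corollary1 n n≥1 F quadratic apn = parity-odd (nonzeroImageSize F) (begin
  parity (nonzeroImageSize F)
    ≡⟨ parity-count n _ ⟩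
  ParSum.∑ n (λ y → not (isZero y) ∧ anyV n (λ a → eqV (Φ F a) y))
    ≡⟨ image-parity n (Φ F) (fibre-parity F quadratic apn) ⟩
  ParSum.∑ n (λ a → not (isZero (Φ F a)))
    ≡⟨ ParSum.∑-ext n (λ a → cong not (isZero-Φ F quadratic apn a)) ⟩
  ParSum.∑ n (λ a → not (isZero a))
    ≡⟨ nonzero-count-odd n n≥1 ⟩
  true ∎)
  where open ≡-Reasoning
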